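{- Let $\mathbf{Q}$ be a (generalized) quantale. The set of all nuclei on $\mathbf{Q}$, ordered pointwise, and the set of all additive consequence relations on $\mathbf{Q}$, ordered by inclusion, are isomorphic (as ordered sets, these being lattices) via the mutually inverse maps ${\vdash}\mapsto\gamma_{\vdash}$ and $\gamma\mapsto{\vdash_\gamma}$, where $\gamma_{\vdash}(x)=\bigvee\{y\in Q: x\vdash y\}$ and $x\vdash_\gamma y\iff y\leq\gamma(x)$.
   Context: Fix one of two parallel settings: plain ("joins" = joins of arbitrary families) or generalized ("joins" = joins of non-empty families). A (generalized) quantale is $\mathbf{Q}=\langle Q,\bigvee,+,\mathsf{0}\rangle$ with $Q$ a poset having all such joins, $\langle Q,+,\mathsf{0}\rangle$ a monoid with $+$ order-preserving, and $+$ distributing over such joins on both sides. A nucleus on $\mathbf{Q}$ is a map $\gamma\colon Q\to Q$ which is order-preserving, expansive ($x\leq\gamma(x)$), idempotent ($\gamma(\gamma(x))=\gamma(x)$), and satisfies $\gamma(x)+\gamma(y)\leq\gamma(x+y)$. An additive consequence relation on $\mathbf{Q}$ is a binary relation $\vdash$ on $Q$ such that for all $x,y,z$: (i) $x\geq y$ implies $x\vdash y$; (ii) $x\vdash y$ and $y\vdash z$ imply $x\vdash z$; (iii) $x\vdash\bigvee\{y: x\vdash y\}$; (iv) $x\vdash y$ implies $x+z\vdash y+z$ and $z+x\vdash z+y$. -}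

module Defs where

open import Level using (Level; suc; _⊔_)
open import Data.Unit.Polymorphic using (⊤)
open import Data.Product using (Σ; ∃; _×_; _,_)
open import Relation.Binary.PropositionalEquality using (_≡_; refl)
open import Relation.Binary.Core using (Rel)
open import Relation.Binary.Structures using (IsPartialOrder)
open import Relation.Unary using (Pred)
open import Algebra.Structures using (IsMonoid)
open import Function.Bundles using (_⇔_)

-- The two parallel settings: plain (joins of arbitrary subsets) and
-- generalized (joins of non-empty subsets).
data Setting : Set where
  plain generalized : Setting

Admissible : ∀ {a} (s : Setting) {A : Set a} → Pred A a → Set a
Admissible plain       P = ⊤
Admissible generalized P = ∃ P

Image : ∀ {a} {A : Set a} → (A → A) → Pred A a → Pred A a
Image f P z = Σ _ λ y → P y × z ≡ f y

image-adm : ∀ {a} (s : Setting) {A : Set a} (f : A → A) (P : Pred A a) →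
            Admissible s P → Admissible s (Image f P)
image-adm plain       f P _       = _
image-adm generalized f P (y , p) = f y , y , p , refl

succ-adm : ∀ {a} (s : Setting) {A : Set a} (_⊢_ : Rel A a) → (∀ x → x ⊢ x) →
           ∀ x → Admissible s (x ⊢_)
succ-adm plain       _⊢_ r x = _
succ-adm generalized _⊢_ r x = x , r x

record Quantale (s : Setting) (ℓ : Level) : Set (suc ℓ) where
  infix  4 _≤_
  infixl 6 _+_
  field
    Q              : Set ℓ
    _≤_            : Rel Q ℓ
    isPartialOrder : IsPartialOrder _≡_ _≤_
    ⋁              : (P : Pred Q ℓ) → Admissible s P → Q
    ⋁-upper        : ∀ P (a : Admissible s P) x → P x → x ≤ ⋁ P a
    ⋁-least        : ∀ P (a : Admissible s P) u → (∀ x → P x → x ≤ u) → ⋁ P a ≤ u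
    _+_            : Q → Q → Q
    𝟘              : Q
    isMonoid       : IsMonoid _≡_ _+_ 𝟘
    +-mono         : ∀ {x x′ y y′} → x ≤ x′ → y ≤ y′ → x + y ≤ x′ + y′
    +-distribˡ-⋁   : ∀ x P (a : Admissible s P) →
                     x + ⋁ P a ≡ ⋁ (Image (x +_) P) (image-adm s (x +_) P a)
    +-distribʳ-⋁   : ∀ x P (a : Admissible s P) →
                     ⋁ P a + x ≡ ⋁ (Image (_+ x) P) (image-adm s (_+ x) P a)

module _ {s : Setting} {ℓ : Level} (𝐐 : Quantale s ℓ) where
  open Quantale 𝐐

  record IsNucleus (γ : Q → Q) : Set ℓ where
    field
      mono       : ∀ {x y} → x ≤ y → γ x ≤ γ y
      expansive  : ∀ x → x ≤ γ x
      idempotent : ∀ x → γ (γ x) ≡ γ x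
      +-lax      : ∀ x y → γ x + γ y ≤ γ (x + y)

  record IsAdditiveConsequence (_⊢_ : Rel Q ℓ) : Set ℓ where
    field
      ≥⇒⊢    : ∀ {x y} → y ≤ x → x ⊢ y
      trans  : ∀ {x y z} → x ⊢ y → y ⊢ z → x ⊢ z
    ⊢-refl : ∀ x → x ⊢ x
    ⊢-refl x = ≥⇒⊢ (IsPartialOrder.refl isPartialOrder)
    field
      ⊢-⋁    : ∀ x → x ⊢ ⋁ (x ⊢_) (succ-adm s _⊢_ ⊢-refl x)
      +-cong : ∀ {x y} z → x ⊢ y → ((x + z) ⊢ (y + z)) × ((z + x) ⊢ (z + y))

  γ[_] : (_⊢_ : Rel Q ℓ) → IsAdditiveConsequence _⊢_ → Q → Q
  γ[ _⊢_ ] c x = ⋁ (x ⊢_) (succ-adm s _⊢_ (IsAdditiveConsequence.⊢-refl c) x)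

  ⊢[_] : (Q → Q) → Rel Q ℓ
  ⊢[ γ ] x y = y ≤ γ x

  _≤ₚ_ : (Q → Q) → (Q → Q) → Set ℓ
  γ ≤ₚ δ = ∀ x → γ x ≤ δ x

  _⊆ᵣ_ : Rel Q ℓ → Rel Q ℓ → Set ℓ
  R ⊆ᵣ S = ∀ x y → R x y → S x y

module Submission where

open import Defs
open import Level using (Level)
open import Data.Product using (_×_; _,_; proj₁; proj₂)
open import Relation.Binary.Core using (Rel)
open import Relation.Binary.PropositionalEquality using (_≡_)
open import Relation.Binary.Structures using (IsPartialOrder)
open import Function.Bundles using (_⇔_; mk⇔)

-- Axiom (iii) says that γ⊢(x) = ⋁{y : x ⊢ y} is itself a consequence of x, so
-- x ⊢ y ⇔ y ≤ γ⊢(x). This characterisation translates the axioms of an additive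
-- consequence relation into those of a nucleus, and shows at once that the two
-- constructions are mutually inverse and that both preserve and reflect order.

module _ {s : Setting} {ℓ : Level} (𝐐 : Quantale s ℓ) where
  open Quantale 𝐐
  open IsPartialOrder isPartialOrder using (antisym; reflexive)
    renaming (refl to ≤-refl; trans to ≤-trans)

  module _ {_⊢_ : Rel Q ℓ} (c : IsAdditiveConsequence 𝐐 _⊢_) where
    open IsAdditiveConsequence c

    ⊢⇒≤γ[⊢] : ∀ {x y} → x ⊢ y → y ≤ γ[ 𝐐 ] _⊢_ c x
    ⊢⇒≤γ[⊢] {x} {y} = ⋁-upper (x ⊢_) _ y

    ≤γ[⊢]⇒⊢ : ∀ {x y} → y ≤ γ[ 𝐐 ] _⊢_ c x → x ⊢ y
    ≤γ[⊢]⇒⊢ {x} y≤γx = trans (⊢-⋁ x) (≥⇒⊢ y≤γx)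

    ⊢[γ[⊢]]⇔⊢ : ∀ x y → ⊢[ 𝐐 ] (γ[ 𝐐 ] _⊢_ c) x y ⇔ x ⊢ y
    ⊢[γ[⊢]]⇔⊢ x y = mk⇔ ≤γ[⊢]⇒⊢ ⊢⇒≤γ[⊢]

    γ[⊢]-isNucleus : IsNucleus 𝐐 (γ[ 𝐐 ] _⊢_ c)
    γ[⊢]-isNucleus = record
      { mono       = λ {x} x≤y → ⋁-least (x ⊢_) _ _ λ z x⊢z →
                       ⊢⇒≤γ[⊢] (trans (≥⇒⊢ x≤y) x⊢z)
      ; expansive  = λ x → ⊢⇒≤γ[⊢] (⊢-refl x)
      ; idempotent = λ x → antisym
                       (⋁-least (γ⊢ x ⊢_) _ _ λ z γx⊢z → ⊢⇒≤γ[⊢] (trans (⊢-⋁ x) γx⊢z))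
                       (⊢⇒≤γ[⊢] (⊢-refl (γ⊢ x)))
      ; +-lax      = λ x y → ⊢⇒≤γ[⊢]
                       (trans (proj₁ (+-cong y (⊢-⋁ x))) (proj₂ (+-cong (γ⊢ x) (⊢-⋁ y))))
      }
      where
      γ⊢ : Q → Q
      γ⊢ = γ[ 𝐐 ] _⊢_ c

  module _ {γ : Q → Q} (n : IsNucleus 𝐐 γ) where
    open IsNucleus n

    ⊢[γ]-isAdditiveConsequence : IsAdditiveConsequence 𝐐 (⊢[ 𝐐 ] γ)
    ⊢[γ]-isAdditiveConsequence = record
      { ≥⇒⊢    = λ {x} y≤x → ≤-trans y≤x (expansive x)
      ; trans  = λ {x} y≤γx z≤γy → ≤-trans z≤γy (≤-trans (mono y≤γx) (reflexive (idempotent x)))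
      ; ⊢-⋁    = λ x → ⋁-least _ _ (γ x) λ _ y≤γx → y≤γx
      ; +-cong = λ {x} z y≤γx →
                   ≤-trans (+-mono y≤γx (expansive z)) (+-lax x z)
                 , ≤-trans (+-mono (expansive z) y≤γx) (+-lax z x)
      }

  -- Neither this nor the next lemma needs γ to be a nucleus.
  γ[⊢[γ]]≗γ : ∀ (γ : Q → Q) (c : IsAdditiveConsequence 𝐐 (⊢[ 𝐐 ] γ)) x →
              γ[ 𝐐 ] (⊢[ 𝐐 ] γ) c x ≡ γ x
  γ[⊢[γ]]≗γ γ c x = antisym (⋁-least _ _ (γ x) λ _ y≤γx → y≤γx) (⋁-upper _ _ (γ x) ≤-refl)

  ≤ₚ⇔⊆ᵣ-⊢[] : ∀ (γ δ : Q → Q) → _≤ₚ_ 𝐐 γ δ ⇔ _⊆ᵣ_ 𝐐 (⊢[ 𝐐 ] γ) (⊢[ 𝐐 ] δ)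
  ≤ₚ⇔⊆ᵣ-⊢[] γ δ = mk⇔ (λ γ≤δ x y y≤γx → ≤-trans y≤γx (γ≤δ x))
                      (λ γ⊆δ x → γ⊆δ x (γ x) ≤-refl)

  ⊆ᵣ⇔≤ₚ-γ[] : ∀ {R S : Rel Q ℓ} (c : IsAdditiveConsequence 𝐐 R) (d : IsAdditiveConsequence 𝐐 S) →
              _⊆ᵣ_ 𝐐 R S ⇔ _≤ₚ_ 𝐐 (γ[ 𝐐 ] R c) (γ[ 𝐐 ] S d)
  ⊆ᵣ⇔≤ₚ-γ[] {R} c d = mk⇔
    (λ R⊆S x → ⋁-least (R x) _ _ λ y xRy → ⊢⇒≤γ[⊢] d (R⊆S x y xRy))
    (λ γR≤γS x y xRy → ≤γ[⊢]⇒⊢ d (≤-trans (⊢⇒≤γ[⊢] c xRy) (γR≤γS x)))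

proposition5p4 : (s : Setting) {ℓ : Level} (𝐐 : Quantale s ℓ) →
    let open Quantale 𝐐 in
    (∀ (_⊢_ : Rel Q ℓ) (c : IsAdditiveConsequence 𝐐 _⊢_) → IsNucleus 𝐐 (γ[_] 𝐐 _⊢_ c))
    × (∀ (γ : Q → Q) → IsNucleus 𝐐 γ → IsAdditiveConsequence 𝐐 (⊢[_] 𝐐 γ))
    × (∀ (γ : Q → Q) (n : IsNucleus 𝐐 γ) (c : IsAdditiveConsequence 𝐐 (⊢[_] 𝐐 γ)) →
         ∀ x → γ[_] 𝐐 (⊢[_] 𝐐 γ) c x ≡ γ x)
    × (∀ (_⊢_ : Rel Q ℓ) (c : IsAdditiveConsequence 𝐐 _⊢_) →
         ∀ x y → (⊢[_] 𝐐 (γ[_] 𝐐 _⊢_ c) x y ⇔ (x ⊢ y)))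
    × (∀ (γ δ : Q → Q) → IsNucleus 𝐐 γ → IsNucleus 𝐐 δ →
         (_≤ₚ_ 𝐐 γ δ ⇔ _⊆ᵣ_ 𝐐 (⊢[_] 𝐐 γ) (⊢[_] 𝐐 δ)))
    × (∀ (R S : Rel Q ℓ) (c : IsAdditiveConsequence 𝐐 R) (d : IsAdditiveConsequence 𝐐 S) →
         (_⊆ᵣ_ 𝐐 R S ⇔ _≤ₚ_ 𝐐 (γ[_] 𝐐 R c) (γ[_] 𝐐 S d)))
proposition5p4 s 𝐐 =
    (λ _ → γ[⊢]-isNucleus 𝐐)
  , (λ _ → ⊢[γ]-isAdditiveConsequence 𝐐)
  , (λ γ _ → γ[⊢[γ]]≗γ 𝐐 γ)
  , (λ _ → ⊢[γ[⊢]]⇔⊢ 𝐐)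
  , (λ γ δ _ _ → ≤ₚ⇔⊆ᵣ-⊢[] 𝐐 γ δ)
  , (λ _ _ → ⊆ᵣ⇔≤ₚ-γ[] 𝐐)
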